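{- A graph $G$ in $\varepsilon_0$ is regular if and only if $G$ is a cycle graph $C_n$ with $n\equiv 0 \pmod 4$. Equivalently, there is no regular graph of degree greater than $2$ in $\varepsilon_0$.
   Context: All graphs are finite, simple, undirected and connected. An Euler graph is a connected graph in which every vertex has even degree. $\varepsilon_0$ denotes the class of Euler graphs $G$ such that every cycle of $G$ has length $n\equiv 0 \pmod 4$. A cycle graph is a graph consisting of a single cycle. -}

module Defs where

open import Data.Nat using (ℕ; zero; suc; _≤_; _<_)
open import Data.Nat.DivMod using (_%_; m%n<n)
open import Data.Nat.Divisibility using (_∣_)
open import Data.Bool using (Bool; true; false; _∨_; T)
open import Data.Fin using (Fin; toℕ; fromℕ<; _≟_)
open import Data.List using (List; length; filter; allFin)
open import Data.Product using (Σ; _×_; ∃)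
open import Relation.Nullary using (¬_; ⌊_⌋)
open import Relation.Binary.PropositionalEquality using (_≡_)
open import Function.Definitions using (Injective; Bijective)

record Graph (n : ℕ) : Set where
  field
    adj    : Fin n → Fin n → Bool
    sym    : ∀ u v → adj u v ≡ adj v u
    irrefl : ∀ u → adj u u ≡ false
open Graph public

Adj : ∀ {n} → Graph n → Fin n → Fin n → Set
Adj G u v = T (adj G u v)

degree : ∀ {n} → Graph n → Fin n → ℕ
degree {n} G v = length (filter (λ w → T? (adj G v w)) (allFin n))
  where
  open import Data.Bool using (T?)

data Walk {n} (G : Graph n) : Fin n → Fin n → Set where
  nil  : ∀ {u} → Walk G u u
  cons : ∀ {u w v} → Adj G u w → Walk G w v → Walk G u v

Connected : ∀ {n} → Graph n → Set
Connected {n} G = (u v : Fin n) → Walk G u v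

Even : ℕ → Set
Even m = 2 ∣ m

EulerGraph : ∀ {n} → Graph n → Set
EulerGraph {n} G = Connected G × ((v : Fin n) → Even (degree G v))

next : ∀ {k} → Fin (suc k) → Fin (suc k)
next {k} i = fromℕ< (m%n<n (suc (toℕ i)) (suc k))

-- A cycle of length (suc m) in G: vertices c 0, …, c m, pairwise distinct,
-- at least 3 of them, with c i adjacent to c (i+1 mod (suc m)).
record Cycle {n} (G : Graph n) (m : ℕ) : Set where
  field
    len≥3 : 3 ≤ suc m
    vert  : Fin (suc m) → Fin n
    inj   : Injective _≡_ _≡_ vert
    edges : ∀ (i : Fin (suc m)) → Adj G (vert i) (vert (next i))

Eps0 : ∀ {n} → Graph n → Set
Eps0 G = EulerGraph G × (∀ m → Cycle G m → 4 ∣ suc m)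

Regular : ∀ {n} → Graph n → Set
Regular {n} G = ∃ λ d → (v : Fin n) → degree G v ≡ d

cycleAdj : ∀ m → Fin (suc m) → Fin (suc m) → Bool
cycleAdj m i j = ⌊ j ≟ next i ⌋ ∨ ⌊ i ≟ next j ⌋

Isomorphic : ∀ {n} → Graph n → (Fin n → Fin n → Bool) → Set
Isomorphic {n} G h = Σ (Fin n → Fin n) λ f →
  Bijective _≡_ _≡_ f × (∀ u v → adj G u v ≡ h (f u) (f v))

IsCycleGraph : ∀ {n} → Graph n → Set
IsCycleGraph {zero}  G = Data.Empty.⊥
  where import Data.Empty
IsCycleGraph {suc m} G = 3 ≤ suc m × Isomorphic G (cycleAdj m)

-- Let v₀ v₁ … v_k be a path that cannot be extended at v₀, so that every neighbour of
-- v₀ lies on it. If v₀ had two neighbours v_b, v_c with 2 ≤ b < c, the cycles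
-- v₀ … v_b, v₀ … v_c and v₀ v_b … v_c would have lengths b + 1, c + 1 and c − b + 2;
-- all three divisible by 4 forces 4 ∣ 2. So some vertex has degree at most 2, which
-- rules out regular graphs of degree ≥ 3, while degrees 0 and 1 are ruled out by
-- connectivity and evenness. In a connected 2-regular graph the same path argument
-- yields a cycle; its vertex set is closed under adjacency, hence it is Hamiltonian,
-- so G ≅ C_n and 4 ∣ n.
module Submission where

open import Defs hiding (sym)
open import Data.Bool using (Bool; true; T; T?)
open import Data.Bool.Properties using (T-∨; T-≡; ⇔→≡)
open import Data.Empty using (⊥; ⊥-elim)
open import Data.Fin using (Fin; toℕ; fromℕ; inject₁; _≟_)
  renaming (zero to fzero; suc to fsuc)
open import Data.Fin.Properties
  using (toℕ-fromℕ<; toℕ-injective; toℕ<n; toℕ≤pred[n]; toℕ-fromℕ; toℕ-inject₁;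
         any?; injective⇒≤; cantor-schröder-bernstein)
open import Data.List using (List; []; _∷_; length; filter; allFin)
open import Data.List.Membership.Propositional using (_∈_)
open import Data.List.Membership.Propositional.Properties using (∈-filter⁺; ∈-filter⁻; ∈-allFin)
open import Data.List.Relation.Unary.All using (_∷_)
open import Data.List.Relation.Unary.Any using (here; there)
open import Data.List.Relation.Unary.Unique.Propositional using (Unique; _∷_)
open import Data.List.Relation.Unary.Unique.Propositional.Properties using (filter⁺; allFin⁺)
import Data.Nat as ℕ
open import Data.Nat using (ℕ; zero; suc; _+_; _∸_; _≤_; _<_; z≤n; s≤s; s≤s⁻¹; z<s; anyUpTo?)
open import Data.Nat.Properties
  using (suc-injective; ≤-reflexive; ≤-trans; <-trans; <-≤-trans; <⇒≤; <⇒≢; <⇒≱; ≰⇒>; ≤∧≢⇒<;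
         <-irrefl; <-cmp; n≤1+n; m≤n+m; m≤n⇒m<n∨m≡n; +-comm; +-suc; +-identityʳ; +-cancelʳ-≡;
         m<n⇒0<n∸m; m∸n+n≡m; m+[n∸m]≡n; m≤o∸n⇒m+n≤o)
open import Data.Nat.DivMod using (_%_; m<n⇒m%n≡m; n%n≡0)
open import Data.Nat.Divisibility using (_∣_; ∣m+n∣m⇒∣n; ∣⇒≤; ∣1⇒≡1)
open import Data.Product using (Σ; ∃; ∃₂; _×_; _,_; proj₁; proj₂)
open import Data.Sum using (_⊎_; inj₁; inj₂)
import Data.Sum as Sum
open import Function.Base using (_∘_)
open import Function.Bundles using (_⇔_; mk⇔; Equivalence)
import Function.Properties.Equivalence as ⇔
open import Relation.Binary.Definitions using (tri<; tri≈; tri>)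
open import Relation.Binary.PropositionalEquality
  using (_≡_; _≢_; refl; sym; trans; cong; cong₂; subst; module ≡-Reasoning)
open import Relation.Nullary using (¬_; Dec; yes; no)
open import Relation.Nullary.Decidable using (map′; toWitness; fromWitness; _×-dec_; ¬?; decidable-stable)

T⇔T⇒≡ : ∀ {a b : Bool} → T a ⇔ T b → a ≡ b
T⇔T⇒≡ a⇔b = ⇔→≡ {z = true} (⇔.trans (⇔.sym T-≡) (⇔.trans a⇔b T-≡))

module _ {A : Set} where

  length≡2⇒∈-pair : ∀ (xs : List A) → length xs ≡ 2 → ∀ {x y z} →
                    x ∈ xs → y ∈ xs → x ≢ y → z ∈ xs → z ≡ x ⊎ z ≡ y
  length≡2⇒∈-pair (a ∷ b ∷ []) _ (here refl) (here refl) x≢y _ = ⊥-elim (x≢y refl)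
  length≡2⇒∈-pair (a ∷ b ∷ []) _ (here refl) (there (here refl)) _ (here refl) = inj₁ refl
  length≡2⇒∈-pair (a ∷ b ∷ []) _ (here refl) (there (here refl)) _ (there (here refl)) = inj₂ refl
  length≡2⇒∈-pair (a ∷ b ∷ []) _ (there (here refl)) (here refl) _ (here refl) = inj₂ refl
  length≡2⇒∈-pair (a ∷ b ∷ []) _ (there (here refl)) (here refl) _ (there (here refl)) = inj₁ refl
  length≡2⇒∈-pair (a ∷ b ∷ []) _ (there (here refl)) (there (here refl)) x≢y _ = ⊥-elim (x≢y refl)

  unique⇒two-distinct : ∀ {xs : List A} → Unique xs → 2 ≤ length xs →
                        ∃₂ λ x y → x ≢ y × x ∈ xs × y ∈ xs
  unique⇒two-distinct {a ∷ b ∷ _} ((a≢b ∷ _) ∷ _) (s≤s (s≤s _)) = a , b , a≢b , here refl , there (here refl)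

  unique⇒three-distinct : ∀ {xs : List A} → Unique xs → 3 ≤ length xs →
                          ∃₂ λ x y → ∃ λ z → x ≢ y × x ≢ z × y ≢ z × x ∈ xs × y ∈ xs × z ∈ xs
  unique⇒three-distinct {a ∷ b ∷ c ∷ _} ((a≢b ∷ a≢c ∷ _) ∷ (b≢c ∷ _) ∷ _) (s≤s (s≤s (s≤s _))) =
    a , b , c , a≢b , a≢c , b≢c , here refl , there (here refl) , there (there (here refl))

  unique-⊆-pair⇒length≡2 : ∀ {xs : List A} → Unique xs → ∀ {x y} → x ∈ xs → y ∈ xs → x ≢ y →
                           (∀ z → z ∈ xs → z ≡ x ⊎ z ≡ y) → length xs ≡ 2
  unique-⊆-pair⇒length≡2 {_ ∷ []} _ (here refl) (here refl) x≢y _ = ⊥-elim (x≢y refl)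
  unique-⊆-pair⇒length≡2 {_ ∷ _ ∷ []} _ _ _ _ _ = refl
  unique-⊆-pair⇒length≡2 {a ∷ b ∷ c ∷ _} ((a≢b ∷ a≢c ∷ _) ∷ (b≢c ∷ _) ∷ _) _ _ _ ⊆xy
    with ⊆xy a (here refl) | ⊆xy b (there (here refl)) | ⊆xy c (there (there (here refl)))
  ... | inj₁ refl | inj₁ refl | _         = ⊥-elim (a≢b refl)
  ... | inj₂ refl | inj₂ refl | _         = ⊥-elim (a≢b refl)
  ... | inj₁ refl | inj₂ refl | inj₁ refl = ⊥-elim (a≢c refl)
  ... | inj₁ refl | inj₂ refl | inj₂ refl = ⊥-elim (b≢c refl)
  ... | inj₂ refl | inj₁ refl | inj₁ refl = ⊥-elim (b≢c refl)
  ... | inj₂ refl | inj₁ refl | inj₂ refl = ⊥-elim (a≢c refl)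

module _ {n : ℕ} (G : Graph n) where

  neighbours : Fin n → List (Fin n)
  neighbours v = filter (λ w → T? (adj G v w)) (allFin n)

  neighbours-unique : ∀ v → Unique (neighbours v)
  neighbours-unique v = filter⁺ (λ w → T? (adj G v w)) {xs = allFin n} (allFin⁺ n)

  ∈-neighbours⁺ : ∀ {v w} → Adj G v w → w ∈ neighbours v
  ∈-neighbours⁺ {v} {w} = ∈-filter⁺ (λ w → T? (adj G v w)) (∈-allFin w)

  ∈-neighbours⁻ : ∀ {v w} → w ∈ neighbours v → Adj G v w
  ∈-neighbours⁻ {v} w∈ = proj₂ (∈-filter⁻ (λ w → T? (adj G v w)) {xs = allFin n} w∈)

  Adj-sym : ∀ {u v} → Adj G u v → Adj G v u
  Adj-sym {u} {v} = subst T (Graph.sym G u v)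

  Adj-irrefl : ∀ {u} → ¬ Adj G u u
  Adj-irrefl {u} = subst T (irrefl G u)

  degree≡0⇒¬Adj : ∀ {v w} → degree G v ≡ 0 → ¬ Adj G v w
  degree≡0⇒¬Adj {v} deg≡0 v~w with neighbours v | ∈-neighbours⁺ v~w
  ... | [] | ()

  degree≡2⇒Adj-pair : ∀ {v x y z} → degree G v ≡ 2 → Adj G v x → Adj G v y → x ≢ y →
                      Adj G v z → z ≡ x ⊎ z ≡ y
  degree≡2⇒Adj-pair {v} deg≡2 v~x v~y x≢y v~z =
    length≡2⇒∈-pair (neighbours v) deg≡2
      (∈-neighbours⁺ v~x) (∈-neighbours⁺ v~y) x≢y (∈-neighbours⁺ v~z)

  2≤degree⇒two-neighbours : ∀ {v} → 2 ≤ degree G v → ∃₂ λ x y → x ≢ y × Adj G v x × Adj G v y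
  2≤degree⇒two-neighbours {v} 2≤deg
    with x , y , x≢y , x∈ , y∈ ← unique⇒two-distinct (neighbours-unique v) 2≤deg
    = x , y , x≢y , ∈-neighbours⁻ x∈ , ∈-neighbours⁻ y∈

  3≤degree⇒three-neighbours : ∀ {v} → 3 ≤ degree G v →
    ∃₂ λ x y → ∃ λ z → x ≢ y × x ≢ z × y ≢ z × Adj G v x × Adj G v y × Adj G v z
  3≤degree⇒three-neighbours {v} 3≤deg
    with x , y , z , x≢y , x≢z , y≢z , x∈ , y∈ , z∈ ← unique⇒three-distinct (neighbours-unique v) 3≤deg
    = x , y , z , x≢y , x≢z , y≢z , ∈-neighbours⁻ x∈ , ∈-neighbours⁻ y∈ , ∈-neighbours⁻ z∈

  Adj-pair⇒degree≡2 : ∀ {v x y} → Adj G v x → Adj G v y → x ≢ y →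
                      (∀ z → Adj G v z → z ≡ x ⊎ z ≡ y) → degree G v ≡ 2
  Adj-pair⇒degree≡2 {v} v~x v~y x≢y only =
    unique-⊆-pair⇒length≡2 (neighbours-unique v) (∈-neighbours⁺ v~x) (∈-neighbours⁺ v~y) x≢y
      (λ z z∈ → only z (∈-neighbours⁻ z∈))

toℕ-next-< : ∀ {m} (i : Fin (suc m)) → toℕ i < m → toℕ (next i) ≡ suc (toℕ i)
toℕ-next-< {m} i i<m = trans (toℕ-fromℕ< _) (m<n⇒m%n≡m (s≤s i<m))

toℕ-next-last : ∀ {m} (i : Fin (suc m)) → toℕ i ≡ m → toℕ (next i) ≡ 0
toℕ-next-last {m} i i≡m =
  trans (toℕ-fromℕ< _) (trans (cong (λ j → suc j % suc m) i≡m) (n%n≡0 (suc m)))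

toℕ-next : ∀ {m} (i : Fin (suc m)) → toℕ i < m × toℕ (next i) ≡ suc (toℕ i)
                                    ⊎ toℕ i ≡ m × toℕ (next i) ≡ 0
toℕ-next i with m≤n⇒m<n∨m≡n (toℕ≤pred[n] i)
... | inj₁ i<m = inj₁ (i<m , toℕ-next-< i i<m)
... | inj₂ i≡m = inj₂ (i≡m , toℕ-next-last i i≡m)

next-injective : ∀ {m} {i j : Fin (suc m)} → next i ≡ next j → i ≡ j
next-injective {i = i} {j} eq with toℕ-next i | toℕ-next j | cong toℕ eq
... | inj₁ (_ , i′) | inj₁ (_ , j′) | e = toℕ-injective (suc-injective (trans (sym i′) (trans e j′)))
... | inj₁ (_ , i′) | inj₂ (_ , j′) | e with () ← trans (sym i′) (trans e j′)
... | inj₂ (_ , i′) | inj₁ (_ , j′) | e with () ← trans (sym j′) (trans (sym e) i′)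
... | inj₂ (i≡m , _) | inj₂ (j≡m , _) | _ = toℕ-injective (trans i≡m (sym j≡m))

next-surjective : ∀ {m} (s : Fin (suc m)) → ∃ λ t → next t ≡ s
next-surjective {m} fzero = fromℕ m , toℕ-injective (toℕ-next-last (fromℕ m) (toℕ-fromℕ m))
next-surjective {suc m} (fsuc s) = inject₁ s , toℕ-injective (begin
  toℕ (next (inject₁ s)) ≡⟨ toℕ-next-< (inject₁ s) (subst (_< suc m) (sym (toℕ-inject₁ s)) (toℕ<n s)) ⟩
  suc (toℕ (inject₁ s))  ≡⟨ cong suc (toℕ-inject₁ s) ⟩
  suc (toℕ s)            ∎)
  where open ≡-Reasoning

next∘next≢id : ∀ {m} → 2 ≤ m → (t : Fin (suc m)) → next (next t) ≢ t
next∘next≢id {m} 2≤m t eq with toℕ-next t | toℕ-next (next t) | cong toℕ eq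
... | inj₁ (_ , x′≡1+x) | inj₁ (_ , x″≡1+x′) | x″≡x =
  <-irrefl (trans (sym x″≡x) (trans x″≡1+x′ (cong suc x′≡1+x))) (s≤s (n≤1+n _))
... | inj₁ (_ , x′≡1+x) | inj₂ (x′≡m , x″≡0) | x″≡x =
  <⇒≢ 2≤m (trans (cong suc (trans (sym x″≡0) x″≡x)) (trans (sym x′≡1+x) x′≡m))
... | inj₂ (x≡m , x′≡0) | inj₁ (_ , x″≡1+x′) | x″≡x =
  <⇒≢ 2≤m (trans (cong suc (sym x′≡0)) (trans (sym x″≡1+x′) (trans x″≡x x≡m)))
... | inj₂ (_ , x′≡0) | inj₂ (x′≡m , _) | _ =
  <⇒≢ (<-trans z<s 2≤m) (trans (sym x′≡0) x′≡m)

T-cycleAdj : ∀ {m} {i j : Fin (suc m)} → T (cycleAdj m i j) ⇔ (j ≡ next i ⊎ i ≡ next j)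
T-cycleAdj {i = i} {j} = ⇔.trans T-∨ (mk⇔
  (Sum.map (toWitness {a? = j ≟ next i}) (toWitness {a? = i ≟ next j}))
  (Sum.map (fromWitness {a? = j ≟ next i}) (fromWitness {a? = i ≟ next j})))

RegularOfDegree : ∀ {n} → Graph n → ℕ → Set
RegularOfDegree {n} G d = (v : Fin n) → degree G v ≡ d

cycleGraph⇒degree≡2 : ∀ {m} {G : Graph (suc m)} → IsCycleGraph G → RegularOfDegree G 2
cycleGraph⇒degree≡2 {m} {G} (3≤1+m , f , (f-injective , f-surjective) , adj≡) v =
  Adj-pair⇒degree≡2 G (cycleAdj⇒Adj (inj₁ (f∘g (next s))))
                      (cycleAdj⇒Adj (inj₂ (trans (sym t′≡s) (cong next (sym (f∘g t)))))) a≢b only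
  where
  g : Fin (suc m) → Fin (suc m)
  g y = proj₁ (f-surjective y)
  f∘g : ∀ y → f (g y) ≡ y
  f∘g y = proj₂ (f-surjective y) refl
  Adj⇒cycleAdj : ∀ {w} → Adj G v w → f w ≡ next (f v) ⊎ f v ≡ next (f w)
  Adj⇒cycleAdj {w} = Equivalence.to T-cycleAdj ∘ subst T (adj≡ v w)
  cycleAdj⇒Adj : ∀ {w} → f w ≡ next (f v) ⊎ f v ≡ next (f w) → Adj G v w
  cycleAdj⇒Adj {w} = subst T (sym (adj≡ v w)) ∘ Equivalence.from T-cycleAdj
  s = f v
  t = proj₁ (next-surjective s)
  t′≡s : next t ≡ s
  t′≡s = proj₂ (next-surjective s)
  a≢b : g (next s) ≢ g t
  a≢b a≡b = next∘next≢id (s≤s⁻¹ 3≤1+m) t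
    (trans (cong next t′≡s) (trans (sym (f∘g (next s))) (trans (cong f a≡b) (f∘g t))))
  only : ∀ z → Adj G v z → z ≡ g (next s) ⊎ z ≡ g t
  only z v~z with Adj⇒cycleAdj v~z
  ... | inj₁ fz≡s′ = inj₁ (f-injective (trans fz≡s′ (sym (f∘g (next s)))))
  ... | inj₂ s≡fz′ = inj₂ (f-injective (trans (next-injective (trans (sym s≡fz′) (sym t′≡s))) (sym (f∘g t))))

InjectiveOn : ∀ {A : Set} → (ℕ → A) → ℕ → Set
InjectiveOn f k = ∀ {i j} → i ≤ k → j ≤ k → f i ≡ f j → i ≡ j

-- Only vertex 0, …, vertex len belong to the path; later values of vertex are junk.
record Path {n : ℕ} (G : Graph n) : Set where
  field
    len       : ℕ
    vertex    : ℕ → Fin n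
    injective : InjectiveOn vertex len
    linked    : ∀ i → i < len → Adj G (vertex i) (vertex (suc i))

module _ {n : ℕ} {G : Graph n} where
  open Path

  Visits : Path G → Fin n → Set
  Visits P w = ∃ λ i → i ≤ len P × vertex P i ≡ w

  visits? : ∀ P w → Dec (Visits P w)
  visits? P w = map′ (λ (i , i<1+len , e) → i , s≤s⁻¹ i<1+len , e) (λ (i , i≤len , e) → i , s≤s i≤len , e)
                     (anyUpTo? (λ i → vertex P i ≟ w) (suc (len P)))

  Unextendable : Path G → Set
  Unextendable P = ∀ w → Adj G (vertex P 0) w → Visits P w

  len<n : (P : Path G) → len P < n
  len<n P = injective⇒≤ {f = vertex P ∘ toℕ}
    (λ {s} {t} e → toℕ-injective (injective P (toℕ≤pred[n] s) (toℕ≤pred[n] t) e))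

  singleton : Fin n → Path G
  singleton v = record { len = 0 ; vertex = λ _ → v ; injective = λ { z≤n z≤n _ → refl } ; linked = λ _ () }

  extend : (w : Fin n) (P : Path G) → Adj G w (vertex P 0) → ¬ Visits P w → Path G
  extend w P w~p₀ w∉P = record { len = suc (len P) ; vertex = vertex′ ; injective = injective′ ; linked = linked′ }
    where
    vertex′ : ℕ → Fin n
    vertex′ zero    = w
    vertex′ (suc i) = vertex P i
    injective′ : InjectiveOn vertex′ (suc (len P))
    injective′ {zero}  {zero}  _  _  _ = refl
    injective′ {zero}  {suc j} _  j≤ e = ⊥-elim (w∉P (j , s≤s⁻¹ j≤ , sym e))
    injective′ {suc i} {zero}  i≤ _  e = ⊥-elim (w∉P (i , s≤s⁻¹ i≤ , e))
    injective′ {suc i} {suc j} i≤ j≤ e = cong suc (injective P (s≤s⁻¹ i≤) (s≤s⁻¹ j≤) e)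
    linked′ : ∀ i → i < suc (len P) → Adj G (vertex′ i) (vertex′ (suc i))
    linked′ zero    _  = w~p₀
    linked′ (suc i) i< = linked P i (s≤s⁻¹ i<)

  prefix : ∀ {c} (P : Path G) → c ≤ len P → Path G
  prefix {c} P c≤len = record
    { len = c ; vertex = vertex P
    ; injective = λ i≤c j≤c → injective P (≤-trans i≤c c≤len) (≤-trans j≤c c≤len)
    ; linked = λ i i<c → linked P i (<-≤-trans i<c c≤len) }

  drop : ∀ b (P : Path G) → b ≤ len P → Path G
  drop b P b≤len = record
    { len = len P ∸ b ; vertex = λ i → vertex P (i + b)
    ; injective = λ {i} {j} i≤ j≤ e →
        +-cancelʳ-≡ b i j (injective P (m≤o∸n⇒m+n≤o i b≤len i≤) (m≤o∸n⇒m+n≤o j b≤len j≤) e)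
    ; linked = λ i i< → linked P (i + b) (m≤o∸n⇒m+n≤o (suc i) b≤len i<) }

  drop-avoids-start : ∀ {b} (P : Path G) (b≤len : b ≤ len P) → 1 ≤ b → ¬ Visits (drop b P b≤len) (vertex P 0)
  drop-avoids-start {b} P b≤len 1≤b (i , i≤ , pᵢ₊ᵦ≡p₀) =
    <⇒≢ (≤-trans 1≤b (m≤n+m b i)) (injective P z≤n (m≤o∸n⇒m+n≤o i b≤len i≤) (sym pᵢ₊ᵦ≡p₀))

  closed⇒Cycle : (P : Path G) → 2 ≤ len P → Adj G (vertex P (len P)) (vertex P 0) → Cycle G (len P)
  closed⇒Cycle P 2≤len pₖ~p₀ = record
    { len≥3 = s≤s 2≤len ; vert = vertex P ∘ toℕ
    ; inj = λ {s} {t} e → toℕ-injective (injective P (toℕ≤pred[n] s) (toℕ≤pred[n] t) e)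
    ; edges = edges }
    where
    edges : ∀ i → Adj G (vertex P (toℕ i)) (vertex P (toℕ (next i)))
    edges i with toℕ-next i
    ... | inj₁ (i<len , i′≡1+i) rewrite i′≡1+i = linked P _ i<len
    ... | inj₂ (i≡len , i′≡0)   rewrite i′≡0 | i≡len = pₖ~p₀

  ∃-unextendable : Fin n → Σ (Path G) Unextendable
  ∃-unextendable v = grow n (singleton v) (≤-reflexive (sym (+-identityʳ n)))
    where
    grow : ∀ fuel (P : Path G) → n ≤ fuel + len P → Σ (Path G) Unextendable
    grow zero P n≤len = ⊥-elim (<⇒≱ (len<n P) n≤len)
    grow (suc fuel) P n≤ with any? (λ w → T? (adj G (vertex P 0) w) ×-dec ¬? (visits? P w))
    ... | yes (w , p₀~w , w∉P) =
      grow fuel (extend w P (Adj-sym G p₀~w) w∉P) (subst (n ≤_) (sym (+-suc fuel (len P))) n≤)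
    ... | no no-new = P , λ w p₀~w → decidable-stable (visits? P w) (λ w∉P → no-new (w , p₀~w , w∉P))

4∤2 : ¬ 4 ∣ 2
4∤2 4∣2 with s≤s (s≤s ()) ← ∣⇒≤ 4∣2

Cycles≡0mod4 : ∀ {n} → Graph n → Set
Cycles≡0mod4 G = ∀ m → Cycle G m → 4 ∣ suc m

module _ {n : ℕ} {G : Graph n} where
  open Path

  record StartEdge (P : Path G) : Set where
    field
      index     : ℕ
      1≤index   : 1 ≤ index
      index≤len : index ≤ len P
      adjacent  : Adj G (vertex P 0) (vertex P index)

  module _ (P : Path G) where
    open StartEdge

    distinct-ends : ∀ {i j x y} → vertex P i ≡ x → vertex P j ≡ y → x ≢ y → i ≢ j
    distinct-ends pᵢ≡x pⱼ≡y x≢y i≡j = x≢y (trans (sym pᵢ≡x) (trans (cong (vertex P) i≡j) pⱼ≡y))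

    unextendable⇒StartEdge : Unextendable P → ∀ {w} → Adj G (vertex P 0) w →
                             Σ (StartEdge P) λ e → vertex P (index e) ≡ w
    unextendable⇒StartEdge unext {w} p₀~w with unext w p₀~w
    ... | zero  , _     , p₀≡w = ⊥-elim (Adj-irrefl G (subst (Adj G (vertex P 0)) (sym p₀≡w) p₀~w))
    ... | suc i , i<len , pᵢ≡w =
      record { index = suc i ; 1≤index = s≤s z≤n ; index≤len = i<len
             ; adjacent = subst (Adj G (vertex P 0)) (sym pᵢ≡w) p₀~w } , pᵢ≡w

    chord⇒Cycle : (e : StartEdge P) → index e ≢ 1 → Cycle G (index e)
    chord⇒Cycle e e≢1 =
      closed⇒Cycle (prefix P (index≤len e)) (≤∧≢⇒< (1≤index e) (e≢1 ∘ sym)) (Adj-sym G (adjacent e))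

    no-two-chords-< : Cycles≡0mod4 G → (e f : StartEdge P) → index e ≢ 1 → index e < index f → ⊥
    no-two-chords-< cycles≡0 e f e≢1 b<c = 4∤2 (∣m+n∣m⇒∣n 4∣d+2 4∣d)
      where
      b = index e
      c = index f
      b≤c = <⇒≤ b<c
      d = c ∸ b
      segment = drop b (prefix P (index≤len f)) b≤c
      bypass : Cycle G (suc d)
      bypass = closed⇒Cycle
        (extend (vertex P 0) segment (adjacent e) (drop-avoids-start (prefix P (index≤len f)) b≤c (1≤index e)))
        (s≤s (m<n⇒0<n∸m b<c))
        (subst (λ i → Adj G (vertex P i) (vertex P 0)) (sym (m∸n+n≡m b≤c)) (Adj-sym G (adjacent f)))
      4∣1+b : 4 ∣ suc b
      4∣1+b = cycles≡0 b (chord⇒Cycle e e≢1)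
      4∣1+b+d : 4 ∣ suc b + d
      4∣1+b+d = subst (λ i → 4 ∣ suc i) (sym (m+[n∸m]≡n b≤c))
        (cycles≡0 c (chord⇒Cycle f (λ c≡1 → <⇒≱ b<c (≤-trans (≤-reflexive c≡1) (1≤index e)))))
      4∣d : 4 ∣ d
      4∣d = ∣m+n∣m⇒∣n 4∣1+b+d 4∣1+b
      4∣d+2 : 4 ∣ d + 2
      4∣d+2 = subst (4 ∣_) (+-comm 2 d) (cycles≡0 (suc d) bypass)

    no-two-chords : Cycles≡0mod4 G → (e f : StartEdge P) → index e ≢ 1 → index f ≢ 1 → index e ≢ index f → ⊥
    no-two-chords cycles≡0 e f e≢1 f≢1 e≢f with <-cmp (index e) (index f)
    ... | tri< e<f _ _ = no-two-chords-< cycles≡0 e f e≢1 e<f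
    ... | tri≈ _ e≡f _ = e≢f e≡f
    ... | tri> _ _ f<e = no-two-chords-< cycles≡0 f e f≢1 f<e

    unextendable⇒start-degree<3 : Cycles≡0mod4 G → Unextendable P → degree G (vertex P 0) < 3
    unextendable⇒start-degree<3 cycles≡0 unext = ≰⇒> no-three
      where
      no-three : ¬ 3 ≤ degree G (vertex P 0)
      no-three 3≤deg with x , y , z , x≢y , x≢z , y≢z , p₀~x , p₀~y , p₀~z ← 3≤degree⇒three-neighbours G 3≤deg
        with ex , pₑ≡x ← unextendable⇒StartEdge unext p₀~x
           | ey , pₑ≡y ← unextendable⇒StartEdge unext p₀~y
           | ez , pₑ≡z ← unextendable⇒StartEdge unext p₀~z
        with ex≢ey ← distinct-ends pₑ≡x pₑ≡y x≢y
           | ex≢ez ← distinct-ends pₑ≡x pₑ≡z x≢z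
           | ey≢ez ← distinct-ends pₑ≡y pₑ≡z y≢z
        with index ex ℕ.≟ 1 | index ey ℕ.≟ 1
      ... | yes x≡1 | _ = no-two-chords cycles≡0 ey ez (ex≢ey ∘ trans x≡1 ∘ sym) (ex≢ez ∘ trans x≡1 ∘ sym) ey≢ez
      ... | no x≢1 | yes y≡1 = no-two-chords cycles≡0 ex ez x≢1 (ey≢ez ∘ trans y≡1 ∘ sym) ex≢ez
      ... | no x≢1 | no y≢1  = no-two-chords cycles≡0 ex ey x≢1 y≢1 ex≢ey

  cycles≡0mod4⇒degree<3 : Cycles≡0mod4 G → Fin n → ∃ λ v → degree G v < 3
  cycles≡0mod4⇒degree<3 cycles≡0 v with P , unext ← ∃-unextendable {G = G} v =
    vertex P 0 , unextendable⇒start-degree<3 P cycles≡0 unext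

  minDegree≥2⇒Cycle : (∀ v → 2 ≤ degree G v) → Fin n → ∃ λ m → Cycle G m
  minDegree≥2⇒Cycle 2≤deg v
    with P , unext ← ∃-unextendable {G = G} v
    with x , y , x≢y , p₀~x , p₀~y ← 2≤degree⇒two-neighbours G (2≤deg (vertex P 0))
    with ex , pₑ≡x ← unextendable⇒StartEdge P unext p₀~x
       | ey , pₑ≡y ← unextendable⇒StartEdge P unext p₀~y
    with StartEdge.index ex ℕ.≟ 1
  ... | yes x≡1 = _ , chord⇒Cycle P ey (distinct-ends P pₑ≡x pₑ≡y x≢y ∘ trans x≡1 ∘ sym)
  ... | no x≢1  = _ , chord⇒Cycle P ex x≢1

Spanning : ∀ {n m} {G : Graph n} → Cycle G m → Set
Spanning {n} C = (v : Fin n) → ∃ λ t → Cycle.vert C t ≡ v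

module _ {n m : ℕ} {G : Graph n} (C : Cycle G m) where
  open Cycle C

  cycle-neighbour : ∀ {s t w} → degree G (vert s) ≡ 2 → next t ≡ s → Adj G (vert s) w →
                    w ≡ vert (next s) ⊎ w ≡ vert t
  cycle-neighbour {s} {t} deg≡2 t′≡s =
    degree≡2⇒Adj-pair G deg≡2 (edges s) (Adj-sym G (subst (λ x → Adj G (vert t) (vert x)) t′≡s (edges t)))
      (λ s′≡t → next∘next≢id (s≤s⁻¹ len≥3) t (trans (cong next t′≡s) (inj s′≡t)))

  Adj-vert⇔ : RegularOfDegree G 2 → ∀ {s t} → Adj G (vert s) (vert t) ⇔ (t ≡ next s ⊎ s ≡ next t)
  Adj-vert⇔ 2-reg {s} {t} = mk⇔ to from
    where
    to : Adj G (vert s) (vert t) → t ≡ next s ⊎ s ≡ next t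
    to s~t with cycle-neighbour (2-reg _) (proj₂ (next-surjective s)) s~t
    ... | inj₁ t≡s′ = inj₁ (inj t≡s′)
    ... | inj₂ t≡r  = inj₂ (trans (sym (proj₂ (next-surjective s))) (cong next (sym (inj t≡r))))
    from : t ≡ next s ⊎ s ≡ next t → Adj G (vert s) (vert t)
    from (inj₁ refl) = edges s
    from (inj₂ refl) = Adj-sym G (edges t)

  2-regular⇒spanning : Connected G → RegularOfDegree G 2 → Spanning C
  2-regular⇒spanning conn 2-reg v = along (conn (vert fzero) v) (fzero , refl)
    where
    along : ∀ {u w} → Walk G u w → ∃ (λ t → vert t ≡ u) → ∃ (λ t → vert t ≡ w)
    along nil on-C = on-C
    along (cons u~x walk) (s , refl) with cycle-neighbour (2-reg _) (proj₂ (next-surjective s)) u~x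
    ... | inj₁ x≡s′ = along walk (next s , sym x≡s′)
    ... | inj₂ x≡r  = along walk (proj₁ (next-surjective s) , sym x≡r)

  spanning⇒length≡ : Spanning C → suc m ≡ n
  spanning⇒length≡ spans = cantor-schröder-bernstein {f = vert} {g = λ v → proj₁ (spans v)} inj
    (λ {u} {v} e → trans (sym (proj₂ (spans u))) (trans (cong vert e) (proj₂ (spans v))))

spanning-2-regular⇒Isomorphic : ∀ {m} {G : Graph (suc m)} (C : Cycle G m) → Spanning C →
                                RegularOfDegree G 2 → Isomorphic G (cycleAdj m)
spanning-2-regular⇒Isomorphic {m} {G} C spans 2-reg = position , (position-injective , position-surjective) , adj≡
  where
  open Cycle C
  position : Fin (suc m) → Fin (suc m)
  position v = proj₁ (spans v)
  vert∘position : ∀ v → vert (position v) ≡ v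
  vert∘position v = proj₂ (spans v)
  position-injective : ∀ {u v} → position u ≡ position v → u ≡ v
  position-injective {u} {v} e = trans (sym (vert∘position u)) (trans (cong vert e) (vert∘position v))
  position-surjective : ∀ t → ∃ λ v → ∀ {u} → u ≡ v → position u ≡ t
  position-surjective t = vert t , λ { refl → inj (vert∘position (vert t)) }
  adj≡ : ∀ u v → adj G u v ≡ cycleAdj m (position u) (position v)
  adj≡ u v = begin
    adj G u v                                     ≡⟨ cong₂ (adj G) (sym (vert∘position u)) (sym (vert∘position v)) ⟩
    adj G (vert (position u)) (vert (position v)) ≡⟨ T⇔T⇒≡ (⇔.trans (Adj-vert⇔ C 2-reg) (⇔.sym T-cycleAdj)) ⟩
    cycleAdj m (position u) (position v)          ∎
    where open ≡-Reasoning

connected-2-regular⇒spanning-Cycle : ∀ {m} {G : Graph (suc m)} → Connected G → RegularOfDegree G 2 →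
                                     Σ (Cycle G m) Spanning
connected-2-regular⇒spanning-Cycle {m} {G} conn 2-reg =
  let k , C = minDegree≥2⇒Cycle (λ v → ≤-reflexive (sym (2-reg v))) fzero
      spans = 2-regular⇒spanning C conn 2-reg
  in  subst (λ k → Σ (Cycle G k) Spanning) (suc-injective (spanning⇒length≡ C spans)) (C , spans)

ε₀-2-regular⇒cycleGraph : ∀ {m} {G : Graph (suc m)} → Eps0 G → RegularOfDegree G 2 → IsCycleGraph G × 4 ∣ suc m
ε₀-2-regular⇒cycleGraph ((conn , _) , cycles≡0) 2-reg =
  let C , spans = connected-2-regular⇒spanning-Cycle conn 2-reg
  in  (Cycle.len≥3 C , spanning-2-regular⇒Isomorphic C spans 2-reg) , cycles≡0 _ C

cycles≡0mod4⇒¬regular>2 : ∀ {n d} {G : Graph n} → 1 ≤ n → Cycles≡0mod4 G → 2 < d → ¬ RegularOfDegree G d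
cycles≡0mod4⇒¬regular>2 {suc _} _ cycles≡0 2<d d-reg =
  let v , deg<3 = cycles≡0mod4⇒degree<3 cycles≡0 fzero
  in  <⇒≱ deg<3 (subst (3 ≤_) (sym (d-reg v)) 2<d)

ε₀-regular⇔cycleGraph : (n : ℕ) (G : Graph n) → 2 ≤ n → Eps0 G → Regular G ⇔ (IsCycleGraph G × 4 ∣ n)
ε₀-regular⇔cycleGraph (suc zero) _ (s≤s ()) _
ε₀-regular⇔cycleGraph (suc (suc m)) G _ ε₀@((conn , even) , cycles≡0) = mk⇔ to from
  where
  to : Regular G → IsCycleGraph G × 4 ∣ suc (suc m)
  to (0 , 0-reg) with cons v~w _ ← conn fzero (fsuc fzero) = ⊥-elim (degree≡0⇒¬Adj G (0-reg fzero) v~w)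
  to (1 , 1-reg) with () ← ∣1⇒≡1 (subst (2 ∣_) (1-reg fzero) (even fzero))
  to (2 , 2-reg) = ε₀-2-regular⇒cycleGraph ε₀ 2-reg
  to (suc (suc (suc d)) , d-reg) = ⊥-elim (cycles≡0mod4⇒¬regular>2 (s≤s z≤n) cycles≡0 (s≤s (s≤s (s≤s z≤n))) d-reg)
  from : IsCycleGraph G × 4 ∣ suc (suc m) → Regular G
  from (cycleGraph , _) = 2 , cycleGraph⇒degree≡2 {G = G} cycleGraph

corollary6p2 :
    ((n : ℕ) (G : Graph n) → 2 ≤ n → Eps0 G →
      (Regular G ⇔ (IsCycleGraph G × 4 ∣ n)))
    × ((n : ℕ) (G : Graph n) (d : ℕ) → 1 ≤ n → Eps0 G → 2 < d →
      ¬ ((v : Fin n) → degree G v ≡ d))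
corollary6p2 = ε₀-regular⇔cycleGraph , λ n G d 1≤n (_ , cycles≡0) → cycles≡0mod4⇒¬regular>2 1≤n cycles≡0
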